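{- For each $\sigma\in\mathfrak{D}_{n,k}$, $\mathrm{ai}(\sigma)=\mathrm{inv}(\sigma)$.
   Context: For $\sigma=\sigma_1\cdots\sigma_n\in\mathfrak{S}_n$ with convention $\sigma_0=\sigma_{n+1}=+\infty$, $\sigma_i$ is a double descent if $\sigma_{i-1}>\sigma_i>\sigma_{i+1}$; $\mathrm{dd}(\sigma)$ counts double descents; $\mathrm{des}(\sigma)=|\{i\in[n-1]:\sigma_i>\sigma_{i+1}\}|$; $\mathrm{inv}(\sigma)$ is the number of pairs $i<j$ with $\sigma_i>\sigma_j$. $\mathfrak{D}_{n,k}=\{\sigma\in\mathfrak{S}_n:\mathrm{dd}(\sigma)=0,\ \mathrm{des}(\sigma)=k\}$. An admissible inversion of $\sigma$ is a pair $(\sigma_i,\sigma_j)$ with $i<j$, $\sigma_i>\sigma_j$, and either ($i>1$ and $\sigma_{i-1}<\sigma_i$) or there exists $l$ with $i<l<j$ and $\sigma_i<\sigma_l$; $\mathrm{ai}(\sigma)$ is the number of admissible inversions. -}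

module Defs where

open import Data.Nat using (ℕ; zero; suc; _+_; _<_; _≤_; _<ᵇ_)
open import Data.Nat.Properties using (_<?_)
open import Data.Fin using (Fin; toℕ; fromℕ<)
open import Data.Fin.Permutation using (Permutation′; _⟨$⟩ʳ_)
open import Data.Bool using (Bool; true; false; _∧_; _∨_; not)
open import Data.List using (List; upTo; length; filter; map; concatMap; sum)
open import Data.Product using (_×_; _,_)
open import Relation.Nullary using (yes; no)

-- One-line notation: a permutation σ ∈ 𝔖ₙ is a bijection Fin n ↔ Fin n,
-- positions are 0-based (position i corresponds to the paper's i+1) and
-- the value at position i is toℕ (σ ⟨$⟩ʳ i) ∈ {0,…,n-1} (the paper's σ_{i+1} - 1;
-- shifting values by one does not affect any comparison).

-- value at a ℕ-position; positions outside [0,n) are never used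
-- without an explicit range guard below.
val : ∀ {n} → Permutation′ n → ℕ → ℕ
val {n} σ i with i <? n
... | yes i<n = toℕ (σ ⟨$⟩ʳ fromℕ< i<n)
... | no _ = 0

_>ᵇ_ : ℕ → ℕ → Bool
a >ᵇ b = b <ᵇ a

-- does σ_{i-1} > σ_i hold, with the convention σ_0 = +∞ (i.e. i = 0 here)
leftBig : ∀ {n} → Permutation′ n → ℕ → Bool
leftBig σ zero = true
leftBig σ (suc i) = val σ i >ᵇ val σ (suc i)

-- does σ_i > σ_{i+1} hold, with the convention σ_{n+1} = +∞
rightSmall : ∀ {n} → Permutation′ n → ℕ → Bool
rightSmall {n} σ i = (suc i <ᵇ n) ∧ (val σ i >ᵇ val σ (suc i))

isDoubleDescent : ∀ {n} → Permutation′ n → ℕ → Bool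
isDoubleDescent σ i = leftBig σ i ∧ rightSmall σ i

count : {A : Set} → (A → Bool) → List A → ℕ
count p xs = length (filter (λ x → p x Data.Bool.≟ true) xs)
  where import Data.Bool

dd : ∀ {n} → Permutation′ n → ℕ
dd {n} σ = count (isDoubleDescent σ) (upTo n)

des : ∀ {n} → Permutation′ n → ℕ
des {n} σ = count (λ i → (suc i <ᵇ n) ∧ (val σ i >ᵇ val σ (suc i))) (upTo n)

pairs : ℕ → List (ℕ × ℕ)
pairs n = concatMap (λ j → map (λ i → i , j) (upTo j)) (upTo n)

inv : ∀ {n} → Permutation′ n → ℕ
inv {n} σ = count (λ { (i , j) → val σ i >ᵇ val σ j }) (pairs n)

existsBigBetween : ∀ {n} → Permutation′ n → ℕ → ℕ → Bool
existsBigBetween σ i j =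
  any (λ l → (i <ᵇ l) ∧ (val σ i <ᵇ val σ l)) (upTo j)
  where open import Data.Bool.ListAction using (any)

-- (paper) i > 1 and σ_{i-1} < σ_i ; here 0-based: i ≥ 1 and σ_{i-1} < σ_i
precededByAscent : ∀ {n} → Permutation′ n → ℕ → Bool
precededByAscent σ zero = false
precededByAscent σ (suc i) = val σ i <ᵇ val σ (suc i)

isAdmissibleInversion : ∀ {n} → Permutation′ n → ℕ → ℕ → Bool
isAdmissibleInversion σ i j =
  (val σ i >ᵇ val σ j) ∧ (precededByAscent σ i ∨ existsBigBetween σ i j)

ai : ∀ {n} → Permutation′ n → ℕ
ai {n} σ = count (λ { (i , j) → isAdmissibleInversion σ i j }) (pairs n)

InD : (n k : ℕ) → Permutation′ n → Set
InD n k σ = (dd σ ≡ 0) × (des σ ≡ k)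
  where open import Relation.Binary.PropositionalEquality using (_≡_)

-- An inversion (σᵢ, σⱼ) fails to be admissible only if σᵢ is not preceded by
-- an ascent and every entry strictly between positions i and j is smaller
-- than σᵢ. The second condition forces σᵢ > σᵢ₊₁ (for j = i + 1 this is the
-- inversion itself), and together with the first it makes σᵢ a double
-- descent. So without double descents every inversion is admissible.
module Submission where

open import Defs
open import Data.Nat using (ℕ; zero; suc; _<_; _<ᵇ_; s≤s)
open import Data.Nat.Properties
  using (_<?_; <⇒<ᵇ; <-irrelevant; <-cmp; <-trans; ≤-<-trans; ≤⇒≯; n<1+n; <-irrefl)
open import Data.Fin using (toℕ; fromℕ<)
open import Data.Fin.Properties using (toℕ-injective; toℕ-fromℕ<)
open import Data.Fin.Permutation using (Permutation′; _⟨$⟩ʳ_)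
open import Data.Bool using (Bool; true; false; T; T?)
open import Data.Bool.Properties using (T-∧; T-∨)
open import Data.List using (List; []; _∷_; upTo; map)
open import Data.List.Membership.Propositional using (_∈_; find; lose)
open import Data.List.Membership.Propositional.Properties
  using (∈-concatMap⁻; ∈-upTo⁺; ∈-upTo⁻; ∈-map⁻)
open import Data.List.Relation.Unary.Any using (here; there)
open import Data.List.Relation.Unary.Any.Properties using (any⁺)
open import Data.Product using (_×_; _,_; proj₁)
open import Data.Sum using (inj₁; inj₂)
open import Data.Empty using (⊥-elim)
open import Data.Unit using (tt)
open import Function.Bundles using (module Equivalence; module Injection)
open import Function.Properties.Inverse using (↔⇒↣)
open import Relation.Nullary using (¬_; yes; no)
open import Relation.Binary using (tri<; tri≈; tri>)
open import Relation.Binary.PropositionalEquality using (_≡_; refl; sym; trans; cong; module ≡-Reasoning)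

open Equivalence using (to; from)

≡-from-T⇔T : ∀ {a b : Bool} → (T a → T b) → (T b → T a) → a ≡ b
≡-from-T⇔T {false} {false} _   _   = refl
≡-from-T⇔T {false} {true}  _   b⇒a = ⊥-elim (b⇒a tt)
≡-from-T⇔T {true}  {false} a⇒b _   = ⊥-elim (a⇒b tt)
≡-from-T⇔T {true}  {true}  _   _   = refl

count-cong : {A : Set} {p q : A → Bool} (xs : List A) →
  (∀ {x} → x ∈ xs → p x ≡ q x) → count p xs ≡ count q xs
count-cong []                   p≗q = refl
count-cong {p = p} {q} (x ∷ xs) p≗q with p x | q x | p≗q (here refl)
... | true  | true  | refl = cong suc (count-cong xs (λ y∈xs → p≗q (there y∈xs)))
... | false | false | refl = count-cong xs (λ y∈xs → p≗q (there y∈xs))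

count≡0⇒¬T : {A : Set} {p : A → Bool} (xs : List A) →
  count p xs ≡ 0 → ∀ {x} → x ∈ xs → ¬ T (p x)
count≡0⇒¬T {p = p} (y ∷ xs) count≡0 x∈ px with p y in py
count≡0⇒¬T (y ∷ xs) ()      x∈          px | true
count≡0⇒¬T (y ∷ xs) count≡0 (here refl) px | false rewrite py = px
count≡0⇒¬T (y ∷ xs) count≡0 (there x∈)  px | false = count≡0⇒¬T xs count≡0 x∈ px

∈-pairs⁻ : ∀ {n i j} → (i , j) ∈ pairs n → i < j × j < n
∈-pairs⁻ {n} ij∈ with find (∈-concatMap⁻ (λ j → map (λ i → i , j) (upTo j)) {xs = upTo n} ij∈)
... | j , j∈ , ij∈row with ∈-map⁻ (λ i → i , j) ij∈row
...   | i , i∈ , refl = ∈-upTo⁻ i∈ , ∈-upTo⁻ j∈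

module _ {n : ℕ} (σ : Permutation′ n) where

  val-fromℕ< : ∀ {i} (i<n : i < n) → val σ i ≡ toℕ (σ ⟨$⟩ʳ fromℕ< i<n)
  val-fromℕ< {i} i<n with i <? n
  ... | yes i<n′ rewrite <-irrelevant i<n i<n′ = refl
  ... | no  i≮n = ⊥-elim (i≮n i<n)

  val-injective : ∀ {a b} → a < n → b < n → val σ a ≡ val σ b → a ≡ b
  val-injective {a} {b} a<n b<n σa≡σb = begin
    a                ≡⟨ toℕ-fromℕ< a<n ⟨
    toℕ (fromℕ< a<n) ≡⟨ cong toℕ (Injection.injective (↔⇒↣ σ) same-image) ⟩
    toℕ (fromℕ< b<n) ≡⟨ toℕ-fromℕ< b<n ⟩
    b                ∎
    where
    open ≡-Reasoning
    same-image : σ ⟨$⟩ʳ fromℕ< a<n ≡ σ ⟨$⟩ʳ fromℕ< b<n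
    same-image = toℕ-injective (trans (sym (val-fromℕ< a<n)) (trans σa≡σb (val-fromℕ< b<n)))

  ¬ascent⇒descent : ∀ {i} → suc i < n →
    ¬ T (val σ i <ᵇ val σ (suc i)) → T (val σ i >ᵇ val σ (suc i))
  ¬ascent⇒descent {i} 1+i<n ¬ascent with <-cmp (val σ i) (val σ (suc i))
  ... | tri< ascent _ _  = ⊥-elim (¬ascent (<⇒<ᵇ ascent))
  ... | tri≈ _ same _    = ⊥-elim (<-irrefl (val-injective (<-trans (n<1+n i) 1+i<n) 1+i<n same) (n<1+n i))
  ... | tri> _ _ descent = <⇒<ᵇ descent

  ¬precededByAscent⇒leftBig : ∀ {i} → i < n → ¬ T (precededByAscent σ i) → T (leftBig σ i)
  ¬precededByAscent⇒leftBig {zero}  _   _        = tt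
  ¬precededByAscent⇒leftBig {suc i} i<n ¬ascent = ¬ascent⇒descent i<n ¬ascent

  ¬existsBigBetween⇒descent : ∀ {i j} → i < j → j < n → T (val σ i >ᵇ val σ j) →
    ¬ T (existsBigBetween σ i j) → T (val σ i >ᵇ val σ (suc i))
  ¬existsBigBetween⇒descent {i} {j} i<j j<n inversion ¬big with <-cmp (suc i) j
  ... | tri< 1+i<j _ _ = ¬ascent⇒descent (<-trans 1+i<j j<n) λ ascent →
    ¬big (any⁺ _ (lose (∈-upTo⁺ 1+i<j) (from T-∧ (<⇒<ᵇ (n<1+n i) , ascent))))
  ... | tri≈ _ refl _        = inversion
  ... | tri> _ _ (s≤s j≤i)   = ⊥-elim (≤⇒≯ j≤i i<j)

  inversion⇒admissible : dd σ ≡ 0 → ∀ {i j} → i < j → j < n →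
    T (val σ i >ᵇ val σ j) → T (isAdmissibleInversion σ i j)
  inversion⇒admissible dd≡0 {i} {j} i<j j<n inversion
    with T? (precededByAscent σ i) | T? (existsBigBetween σ i j)
  ... | yes ascent | _       = from T-∧ (inversion , from T-∨ (inj₁ ascent))
  ... | no _       | yes big = from T-∧ (inversion , from T-∨ (inj₂ big))
  ... | no ¬ascent | no ¬big = ⊥-elim (count≡0⇒¬T (upTo n) dd≡0 (∈-upTo⁺ i<n) doubleDescent)
    where
    i<n : i < n
    i<n = <-trans i<j j<n
    1+i<n : suc i < n
    1+i<n = ≤-<-trans i<j j<n
    doubleDescent : T (isDoubleDescent σ i)
    doubleDescent = from T-∧ ( ¬precededByAscent⇒leftBig i<n ¬ascent
                             , from T-∧ (<⇒<ᵇ 1+i<n , ¬existsBigBetween⇒descent i<j j<n inversion ¬big))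

  admissible≡inversion : dd σ ≡ 0 → ∀ {i j} → i < j → j < n →
    isAdmissibleInversion σ i j ≡ (val σ i >ᵇ val σ j)
  admissible≡inversion dd≡0 i<j j<n =
    ≡-from-T⇔T (λ admissible → proj₁ (to T-∧ admissible)) (inversion⇒admissible dd≡0 i<j j<n)

lemma2p2 : (n k : ℕ) → (σ : Permutation′ n) → InD n k σ → ai σ ≡ inv σ
lemma2p2 n k σ (dd≡0 , _) = count-cong (pairs n) λ {(i , j)} ij∈pairs →
  let i<j , j<n = ∈-pairs⁻ ij∈pairs in admissible≡inversion σ dd≡0 i<j j<n
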